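{- Let $m\geq 2$, $n=4m$, $G=\langle x,y:~x^n=y^2=e,~yxy=x^{ -1}\rangle$, $A=\langle x\rangle$, $B=\langle y\rangle$, let $A_0$ be the subgroup of $A$ of order $4$ with generator $x_0$, and $G_0=A_0B$. Let $R=\{x_0^2,yx_0,yx_0^2,yx_0^3\}\cup(G\setminus G_0)$ and $\Lambda=\mathrm{Cay}(G,R)$. Then the WL-closure of $\Lambda$ is the S-ring over $G$ whose basic sets are exactly $Y_0=\{e\}$, $Y_1=\{yx_0^2\}$, $Y_2=\{y,x_0,x_0^3\}$, $Y_3=\{x_0^2,yx_0,yx_0^3\}$, $Y_4=G\setminus G_0$. In particular, the WL-rank of $\Lambda$ equals $5$.
   Context: $\mathrm{Cay}(G,S)$ has vertex set $G$ and edges $\{g,sg\}$. For $X\subseteq G$, $\underline{X}=\sum_{x\in X}x$. An S-ring over $G$ is a subring $\mathcal{A}\subseteq\mathbb{Z}G$ spanned by $\underline{X}$, $X$ ranging over a partition of $G$ (basic sets) containing $\{e\}$ and closed under inversion; its rank is the number of basic sets. The WL-closure of $\mathrm{Cay}(G,S)$ is the smallest S-ring over $G$ in which $S$ is a union of basic sets; the WL-rank is its rank. -}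

module Defs where

open import Data.Bool using (Bool; true; false; if_then_else_; _xor_)
open import Data.Nat as ℕ using (ℕ; zero; suc; _≤_; NonZero)
open import Data.Nat.Properties using (m*n≢0)
open import Data.Nat.DivMod using (_mod_)
open import Data.Fin using (Fin; toℕ)
open import Data.Integer as ℤ using (ℤ)
open import Data.List using (List; map; concatMap; foldr)
open import Data.Vec using (allFin; toList)
open import Data.Product using (Σ; ∃; _×_; _,_)
open import Data.Sum using (_⊎_)
open import Relation.Nullary using (¬_; does)
open import Relation.Binary.PropositionalEquality using (_≡_)
open import Function using (_⇔_)

-- A finite group given concretely: carrier, multiplication, identity,
-- inverse and a list enumerating all elements (each exactly once).
record FinGroup : Set₁ where
  field
    Carrier : Set
    _·_     : Carrier → Carrier → Carrier
    e       : Carrier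
    inv     : Carrier → Carrier
    elems   : List Carrier

module _ (G : FinGroup) where
  open FinGroup G

  ℤG : Set
  ℤG = Carrier → ℤ

  sumℤ : List ℤ → ℤ
  sumℤ = foldr ℤ._+_ (ℤ.+ 0)

  conv : ℤG → ℤG → ℤG
  conv f g h = sumℤ (map (λ a → f a ℤ.* g (inv a · h)) elems)

  -- A partition of G is given as the fibres of a labelling c : G → ℕ.
  -- The basic set containing a is { g | c g ≡ c a }; its "underline"
  -- element of ℤG is its indicator:
  basicSum : (Carrier → ℕ) → Carrier → ℤG
  basicSum c a g = if does (c g ℕ.≟ c a) then ℤ.+ 1 else ℤ.+ 0

  -- f ∈ ℤG lies in the ℤ-span of the basic-set sums iff it is constant
  -- on each basic set.
  InSpan : (Carrier → ℕ) → ℤG → Set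
  InSpan c f = ∀ g h → c g ≡ c h → f g ≡ f h

  -- The span of the basic-set sums is an S-ring:
  --  {e} is a basic set, the partition is closed under inversion, and
  --  the span is closed under multiplication (equivalently, by
  --  bilinearity, products of basic-set sums lie in the span).
  -- (It contains 1 = e̲ and is closed under +,- automatically.)
  record IsSRing (c : Carrier → ℕ) : Set where
    field
      singleton-e : ∀ g → c g ≡ c e → g ≡ e
      inv-closed  : ∀ g h → c g ≡ c h → c (inv g) ≡ c (inv h)
      mul-closed  : ∀ a b → InSpan c (conv (basicSum c a) (basicSum c b))

  UnionOfBasic : (Carrier → ℕ) → (Carrier → Set) → Set
  UnionOfBasic c S = ∀ g h → c g ≡ c h → S g → S h

  -- S-ring A (labelling c) is contained in S-ring A' (labelling c')
  -- iff every basic set of A is a union of basic sets of A'.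
  SubSRing : (Carrier → ℕ) → (Carrier → ℕ) → Set
  SubSRing c c' = ∀ g h → c' g ≡ c' h → c g ≡ c h

  -- c is the WL-closure of Cay(G,S): the smallest S-ring in which S is a
  -- union of basic sets.
  record IsWLClosure (S : Carrier → Set) (c : Carrier → ℕ) : Set₁ where
    field
      sring    : IsSRing c
      S-union  : UnionOfBasic c S
      smallest : ∀ (c' : Carrier → ℕ) → IsSRing c' → UnionOfBasic c' S →
                 SubSRing c c'

  HasRank : (Carrier → ℕ) → ℕ → Set
  HasRank c k = Σ (Fin k → Carrier) λ r →
                  (∀ i j → c (r i) ≡ c (r j) → i ≡ j) ×
                  (∀ g → ∃ λ i → c g ≡ c (r i))

  BasicSetsAre : (c : Carrier → ℕ) (k : ℕ) (Y : Fin k → Carrier → Set) → Set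
  BasicSetsAre c k Y =
    (∀ i → ∃ λ g → Y i g) ×
    (∀ g h → (c g ≡ c h) ⇔ (∃ λ i → Y i g × Y i h))

-- The dihedral group  D n = ⟨x,y : xⁿ = y² = e, yxy = x⁻¹⟩
-- Element (b , i) stands for  yᵇ xⁱ  (b = false: xⁱ, b = true: y xⁱ).

module Dihedral (n : ℕ) .{{_ : NonZero n}} where

  Elt : Set
  Elt = Bool × Fin n

  addF : Fin n → Fin n → Fin n
  addF i j = (toℕ i ℕ.+ toℕ j) mod n

  negF : Fin n → Fin n
  negF i = (n ℕ.∸ toℕ i) mod n

  -- (yᵃ xⁱ)(yᵇ xʲ) = y^{a+b} x^{±i + j}, sign − iff b = true
  mul : Elt → Elt → Elt
  mul (a , i) (b , j) = (a xor b , addF (if b then negF i else i) j)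

  one : Elt
  one = (false , 0 mod n)

  invD : Elt → Elt
  invD (false , i) = (false , negF i)
  invD (true  , i) = (true  , i)

  D : FinGroup
  D = record
    { Carrier = Elt
    ; _·_     = mul
    ; e       = one
    ; inv     = invD
    ; elems   = concatMap (λ b → map (λ i → (b , i)) (toList (allFin n)))
                          (false Data.List.∷ true Data.List.∷ Data.List.[])
    }

  x y : Elt
  x = (false , 1 mod n)
  y = (true  , 0 mod n)

  xpow : ℕ → Elt
  xpow k = (false , k mod n)

module Setting (m : ℕ) .{{_ : NonZero m}} where

  n : ℕ
  n = 4 ℕ.* m

  instance
    nz-n : NonZero n
    nz-n = m*n≢0 4 m

  open Dihedral n public

  G : FinGroup
  G = D

  _·_ : Elt → Elt → Elt
  _·_ = mul

  x₀ : Elt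
  x₀ = xpow m

  x₀² x₀³ : Elt
  x₀² = x₀ · x₀
  x₀³ = x₀² · x₀

  InA₀ : Elt → Set
  InA₀ g = ∃ λ (k : ℕ) → g ≡ (false , (k ℕ.* m) mod n)

  InB : Elt → Set
  InB g = g ≡ one ⊎ g ≡ y

  InG₀ : Elt → Set
  InG₀ g = ∃ λ a → ∃ λ b → InA₀ a × InB b × g ≡ a · b

  R : Elt → Set
  R g = g ≡ x₀² ⊎ g ≡ y · x₀ ⊎ g ≡ y · x₀² ⊎ g ≡ y · x₀³ ⊎ ¬ InG₀ g

  Y : Fin 5 → Elt → Set
  Y Fin.zero g = g ≡ one
  Y (Fin.suc Fin.zero) g = g ≡ y · x₀²
  Y (Fin.suc (Fin.suc Fin.zero)) g = g ≡ y ⊎ g ≡ x₀ ⊎ g ≡ x₀³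
  Y (Fin.suc (Fin.suc (Fin.suc Fin.zero))) g =
    g ≡ x₀² ⊎ g ≡ y · x₀ ⊎ g ≡ y · x₀³
  Y (Fin.suc (Fin.suc (Fin.suc (Fin.suc Fin.zero)))) g = ¬ InG₀ g

  Conclusion : Set₁
  Conclusion = Σ (Elt → ℕ) λ c →
                 IsWLClosure G R c × BasicSetsAre G c 5 Y × HasRank G c 5

2≤⇒NonZero : ∀ {m} → 2 ≤ m → NonZero m
2≤⇒NonZero (ℕ.s≤s _) = _

-- G₀ = ⟨x₀, y⟩ is a copy ι D₄ of the dihedral group of order 8. A function on G that is
-- constant on G ∖ G₀ is a constant plus the extension by zero of a function on D₄, and such
-- functions are closed under the product of ℤG, the D₄-part of a product being the product
-- in ℤD₄. Hence adjoining G ∖ G₀ as one further basic set to an S-ring over D₄ gives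
-- an S-ring over G. The partition {e}, {yx₀²}, {y, x₀, x₀³}, {x₀², yx₀, yx₀³} of D₄ is an
-- S-ring (a finite computation), so Y₀, …, Y₄ are the basic sets of an S-ring in which
-- R = Y₁ ∪ Y₃ ∪ Y₄ is a union of basic sets.
--
-- Conversely, in an S-ring in which R is a union of basic sets, {e} and R, hence also
-- Y₂ = G ∖ ({e} ∪ R), are unions of basic sets. The coefficients of Y₂Y₂ separate Y₃ from
-- Y₁ ∪ Y₄, and those of Y₂Y₃ separate Y₁ from Y₄; since Y₂ and Y₃ lie in G₀, these
-- coefficients are computed in ℤD₄. So each Yᵢ is a union of basic sets of any such S-ring.
-- Finally x ∉ G₀ as m ≥ 2, so Y₄ is nonempty and the rank is 5.

module Submission where

open import Defs
open import Level using (0ℓ)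
open import Algebra.Bundles using (Group; AbelianGroup)
open import Algebra.Structures using (IsGroup; IsAbelianGroup)
open import Data.Bool as Bool using (Bool; true; false; T; if_then_else_; _∨_; _xor_)
open import Data.Bool.Properties using (∨-zeroʳ; xor-assoc)
open import Data.Bool.ListAction using (any)
open import Data.Nat as ℕ using (ℕ; NonZero; _≤_)
import Data.Nat.Properties as ℕ
open import Data.Nat.DivMod
open import Data.Fin as Fin using (Fin; zero; suc; toℕ)
open import Data.Fin.Patterns using (0F; 1F; 2F; 3F; 4F)
open import Data.Fin.Properties using (toℕ-injective; toℕ<n; toℕ-fromℕ<)
open import Data.Integer as ℤ using (ℤ; +_; _+_; _*_; _-_)
import Data.Integer.Properties as ℤ
open import Data.Integer.Solver using (module +-*-Solver)
open import Data.List using (List; []; _∷_; map; foldr; _++_)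
open import Data.List.Properties using (map-∘)
open import Data.List.Membership.Propositional using (_∈_)
open import Data.List.Membership.Propositional.Properties using (∈-map⁺; ∈-++⁺ˡ; ∈-++⁺ʳ)
open import Data.List.Relation.Unary.Any using (here; there)
import Data.List.Relation.Unary.All as All
open import Data.Vec as Vec using (toList; allFin)
open import Data.Vec.Properties using (toList-map; allFin-map)
open import Data.Vec.Membership.Propositional.Properties using (∈-toList⁺; ∈-allFin⁺)
open import Data.Maybe as Maybe using (Maybe; just; nothing; maybe; maybe′)
open import Data.Maybe.Properties using (just-injective; maybe′-map)
open import Data.Product using (∃; _×_; _,_; proj₁; proj₂)
open import Data.Product.Properties using (≡-dec)
open import Data.Sum using (inj₁; inj₂)
open import Data.Empty using (⊥-elim)
open import Function using (_∘_; _⇔_; mk⇔; Equivalence)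
open import Relation.Binary.Definitions using (DecidableEquality)
open import Relation.Nullary using (¬_; ¬?; Dec; does; yes; no)
open import Relation.Nullary.Decidable
  using (map′; _×-dec_; _→-dec_; toWitness; T?; does-⇔; dec-true; dec-false)
open import Relation.Unary using (Decidable)
open import Relation.Binary.PropositionalEquality
open import Algebra.Properties.CommutativeSemigroup ℤ.+-commutativeSemigroup
  using () renaming (interchange to +-interchange)
open import Algebra.Properties.CommutativeSemigroup ℤ.*-commutativeSemigroup
  using () renaming (interchange to *-interchange)

-- ∑ xs f unfolds to sumℤ G (map f xs), the sum in the definition of conv.
∑ : {A : Set} → List A → (A → ℤ) → ℤ
∑ xs f = foldr _+_ (+ 0) (map f xs)

∑-cong : {A : Set} (xs : List A) {f g : A → ℤ} → f ≗ g → ∑ xs f ≡ ∑ xs g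
∑-cong []       f≗g = refl
∑-cong (x ∷ xs) f≗g = cong₂ _+_ (f≗g x) (∑-cong xs f≗g)

∑-zero : {A : Set} (xs : List A) → ∑ xs (λ _ → + 0) ≡ + 0
∑-zero []       = refl
∑-zero (x ∷ xs) = trans (ℤ.+-identityˡ _) (∑-zero xs)

∑-distrib-+ : {A : Set} (xs : List A) (f g : A → ℤ) → ∑ xs (λ a → f a + g a) ≡ ∑ xs f + ∑ xs g
∑-distrib-+ []       f g = refl
∑-distrib-+ (x ∷ xs) f g =
  trans (cong (_+_ (f x + g x)) (∑-distrib-+ xs f g)) (+-interchange (f x) (g x) (∑ xs f) (∑ xs g))

*-distribˡ-∑ : {A : Set} (k : ℤ) (xs : List A) (f : A → ℤ) → k * ∑ xs f ≡ ∑ xs (λ a → k * f a)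
*-distribˡ-∑ k []       f = ℤ.*-zeroʳ k
*-distribˡ-∑ k (x ∷ xs) f = trans (ℤ.*-distribˡ-+ k (f x) _) (cong (_+_ (k * f x)) (*-distribˡ-∑ k xs f))

*-distribʳ-∑ : {A : Set} (k : ℤ) (xs : List A) (f : A → ℤ) → ∑ xs f * k ≡ ∑ xs (λ a → f a * k)
*-distribʳ-∑ k xs f = trans (ℤ.*-comm (∑ xs f) k)
  (trans (*-distribˡ-∑ k xs f) (∑-cong xs (λ a → ℤ.*-comm k (f a))))

∑-++ : {A : Set} (xs ys : List A) (f : A → ℤ) → ∑ (xs ++ ys) f ≡ ∑ xs f + ∑ ys f
∑-++ []       ys f = sym (ℤ.+-identityˡ _)
∑-++ (x ∷ xs) ys f = trans (cong (_+_ (f x)) (∑-++ xs ys f)) (sym (ℤ.+-assoc (f x) _ _))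

∑-map : {A B : Set} (h : B → A) (xs : List B) (f : A → ℤ) → ∑ (map h xs) f ≡ ∑ xs (f ∘ h)
∑-map h xs f = cong (foldr _+_ (+ 0)) (sym (map-∘ xs))

∑-comm : {A B : Set} (xs : List A) (ys : List B) (f : A → B → ℤ) →
         ∑ xs (λ a → ∑ ys (f a)) ≡ ∑ ys (λ b → ∑ xs (λ a → f a b))
∑-comm []       ys f = sym (∑-zero ys)
∑-comm (x ∷ xs) ys f = trans (cong (_+_ (∑ ys (f x))) (∑-comm xs ys f))
                             (sym (∑-distrib-+ ys (f x) (λ b → ∑ xs (λ a → f a b))))

∑-*-∑ : {A B : Set} (xs : List A) (ys : List B) (f : A → ℤ) (g : B → ℤ) →
        ∑ xs f * ∑ ys g ≡ ∑ xs (λ a → ∑ ys (λ b → f a * g b))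
∑-*-∑ xs ys f g = trans (*-distribʳ-∑ (∑ ys g) xs f) (∑-cong xs (λ a → *-distribˡ-∑ (f a) ys g))

∑-allFin-suc : ∀ {k} (f : Fin (ℕ.suc k) → ℤ) →
               ∑ (toList (allFin (ℕ.suc k))) f ≡ f zero + ∑ (toList (allFin k)) (f ∘ suc)
∑-allFin-suc {k} f = begin
  ∑ (toList (allFin (ℕ.suc k))) f                ≡⟨ cong (λ v → ∑ (toList v) f) (allFin-map k) ⟩
  f zero + ∑ (toList (Vec.map suc (allFin k))) f ≡⟨ cong (λ v → f zero + ∑ v f) (toList-map suc (allFin k)) ⟩
  f zero + ∑ (map suc (toList (allFin k))) f     ≡⟨ cong (_+_ (f zero)) (∑-map suc (toList (allFin k)) f) ⟩
  f zero + ∑ (toList (allFin k)) (f ∘ suc)       ∎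
  where open ≡-Reasoning

∑-allFin-δ : ∀ {k} (t : Fin k) (ψ : Fin k → ℤ) →
             ∑ (toList (allFin k)) (λ i → if does (i Fin.≟ t) then ψ i else + 0) ≡ ψ t
∑-allFin-δ {ℕ.suc k} zero ψ = begin
  ∑ (toList (allFin (ℕ.suc k))) (λ i → if does (i Fin.≟ zero) then ψ i else + 0)
    ≡⟨ ∑-allFin-suc (λ i → if does (i Fin.≟ zero) then ψ i else + 0) ⟩
  ψ zero + ∑ (toList (allFin k)) (λ _ → + 0)
    ≡⟨ cong (_+_ (ψ zero)) (∑-zero (toList (allFin k))) ⟩
  ψ zero + + 0
    ≡⟨ ℤ.+-identityʳ (ψ zero) ⟩
  ψ zero ∎
  where open ≡-Reasoning
∑-allFin-δ {ℕ.suc k} (suc t) ψ =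
  trans (∑-allFin-suc (λ i → if does (i Fin.≟ suc t) then ψ i else + 0))
        (trans (ℤ.+-identityˡ _) (∑-allFin-δ t (ψ ∘ suc)))

record IsFiniteGroup (G : FinGroup) : Set where
  open FinGroup G
  infix 4 _≟_
  field
    isGroup : IsGroup _≡_ _·_ e inv
    _≟_     : DecidableEquality Carrier
    ∈-elems : ∀ g → g ∈ elems
    -- elems lists every element exactly once
    ∑-δ     : ∀ t (ψ : Carrier → ℤ) → ∑ elems (λ a → if does (a ≟ t) then ψ a else + 0) ≡ ψ t

module GroupRingProperties {G : FinGroup} (G-finite : IsFiniteGroup G) where
  open FinGroup G
  open IsFiniteGroup G-finite

  group : Group 0ℓ 0ℓ
  group = record { isGroup = isGroup }

  open import Algebra.Properties.Group group
    using ( ⁻¹-anti-homo-∙; ⁻¹-involutive; identityˡ-unique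
          ; \\-leftDividesˡ; \\-leftDividesʳ; //-rightDividesˡ) public

  ⁻¹·≡⇔≡·⁻¹ : ∀ a h t → inv a · h ≡ t ⇔ a ≡ h · inv t
  ⁻¹·≡⇔≡·⁻¹ a h t = mk⇔ to from
    where
    open ≡-Reasoning
    to : inv a · h ≡ t → a ≡ h · inv t
    to refl = sym (begin
      h · inv (inv a · h)     ≡⟨ cong (h ·_) (⁻¹-anti-homo-∙ (inv a) h) ⟩
      h · (inv h · inv (inv a)) ≡⟨ cong (λ v → h · (inv h · v)) (⁻¹-involutive a) ⟩
      h · (inv h · a)         ≡⟨ \\-leftDividesˡ h a ⟩
      a                       ∎)
    from : a ≡ h · inv t → inv a · h ≡ t
    from refl = begin
      inv (h · inv t) · h       ≡⟨ cong (_· h) (⁻¹-anti-homo-∙ h (inv t)) ⟩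
      (inv (inv t) · inv h) · h ≡⟨ cong (λ v → (v · inv h) · h) (⁻¹-involutive t) ⟩
      (t · inv h) · h           ≡⟨ //-rightDividesˡ h t ⟩
      t                         ∎

  ∑-δ′ : ∀ t (ψ : Carrier → ℤ) → ∑ elems (λ a → if does (t ≟ a) then ψ a else + 0) ≡ ψ t
  ∑-δ′ t ψ = trans (∑-cong elems (λ a → cong (λ b → if b then ψ a else + 0)
                                              (does-⇔ (mk⇔ sym sym) (t ≟ a) (a ≟ t))))
                   (∑-δ t ψ)

  ∑-translate : ∀ (F : Carrier → ℤ) h → ∑ elems (λ a → F (inv a · h)) ≡ ∑ elems F
  ∑-translate F h = begin
    ∑ elems (λ a → F (inv a · h))
      ≡⟨ ∑-cong elems (λ a → sym (∑-δ′ (inv a · h) F)) ⟩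
    ∑ elems (λ a → ∑ elems (λ t → if does (inv a · h ≟ t) then F t else + 0))
      ≡⟨ ∑-comm elems elems (λ a t → if does (inv a · h ≟ t) then F t else + 0) ⟩
    ∑ elems (λ t → ∑ elems (λ a → if does (inv a · h ≟ t) then F t else + 0))
      ≡⟨ ∑-cong elems (λ t → ∑-cong elems (λ a → cong (λ b → if b then F t else + 0)
           (does-⇔ (⁻¹·≡⇔≡·⁻¹ a h t) (inv a · h ≟ t) (a ≟ h · inv t)))) ⟩
    ∑ elems (λ t → ∑ elems (λ a → if does (a ≟ h · inv t) then F t else + 0))
      ≡⟨ ∑-cong elems (λ t → ∑-δ (h · inv t) (λ _ → F t)) ⟩
    ∑ elems F ∎
    where open ≡-Reasoning

  ∀? : {P : Carrier → Set} → Decidable P → Dec (∀ g → P g)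
  ∀? P? = map′ (λ all g → All.lookup all (∈-elems g)) (λ ∀P → All.tabulate (λ {g} _ → ∀P g))
               (All.all? P? elems)

  const : ℤ → ℤG G
  const α _ = α

  _+ᶠ_ : ℤG G → ℤG G → ℤG G
  (f +ᶠ g) h = f h + g h

  conv-cong : ∀ {f f′ g g′} → f ≗ f′ → g ≗ g′ → conv G f g ≗ conv G f′ g′
  conv-cong f≗f′ g≗g′ h = ∑-cong elems (λ a → cong₂ _*_ (f≗f′ a) (g≗g′ (inv a · h)))

  conv-distribʳ : ∀ f g k → conv G (f +ᶠ g) k ≗ conv G f k +ᶠ conv G g k
  conv-distribʳ f g k h = trans (∑-cong elems (λ a → ℤ.*-distribʳ-+ (k (inv a · h)) (f a) (g a)))
                                (∑-distrib-+ elems _ _)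

  conv-distribˡ : ∀ f g k → conv G k (f +ᶠ g) ≗ conv G k f +ᶠ conv G k g
  conv-distribˡ f g k h = trans (∑-cong elems (λ a → ℤ.*-distribˡ-+ (k a) (f (inv a · h)) (g (inv a · h))))
                                (∑-distrib-+ elems _ _)

  conv-constˡ : ∀ α f → conv G (const α) f ≗ const (α * ∑ elems f)
  conv-constˡ α f h = trans (sym (*-distribˡ-∑ α elems (λ a → f (inv a · h))))
                            (cong (α *_) (∑-translate f h))

  conv-constʳ : ∀ f β → conv G f (const β) ≗ const (∑ elems f * β)
  conv-constʳ f β h = sym (*-distribʳ-∑ β elems f)

  -- A function constant on the classes of c is a ℤ-combination of the basic sums of one
  -- representative per class, so closure of the span under conv reduces to mul-closed.
  module _ (c : Carrier → ℕ) where

    covers : List Carrier → ℕ → Bool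
    covers L k = any (λ r → does (k ℕ.≟ c r)) L

    classReps : List Carrier → List Carrier
    classReps []      = []
    classReps (r ∷ L) = if covers (classReps L) (c r) then classReps L else r ∷ classReps L

    basicSum-≡ : ∀ {r x} → c x ≡ c r → basicSum G c r x ≡ + 1
    basicSum-≡ {r} {x} cx≡cr = cong (λ b → if b then + 1 else + 0) (dec-true (c x ℕ.≟ c r) cx≡cr)

    basicSum-≢ : ∀ {r x} → c x ≢ c r → basicSum G c r x ≡ + 0
    basicSum-≢ {r} {x} cx≢cr = cong (λ b → if b then + 1 else + 0) (dec-false (c x ℕ.≟ c r) cx≢cr)

    covers-∷-≡ : ∀ {r L k} → k ≡ c r → covers (r ∷ L) k ≡ true
    covers-∷-≡ {r} {L} {k} k≡cr = cong (_∨ covers L k) (dec-true (k ℕ.≟ c r) k≡cr)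

    covers-∷-≢ : ∀ {r L k} → k ≢ c r → covers (r ∷ L) k ≡ covers L k
    covers-∷-≢ {r} {L} {k} k≢cr = cong (_∨ covers L k) (dec-false (k ℕ.≟ c r) k≢cr)

    covers-∷ : ∀ r L → covers L (c r) ≡ true → ∀ k → covers (r ∷ L) k ≡ covers L k
    covers-∷ r L covered k with k ℕ.≟ c r
    ... | yes k≡cr = trans (covers-∷-≡ {r} {L} k≡cr) (sym (trans (cong (covers L) k≡cr) covered))
    ... | no  k≢cr = covers-∷-≢ {r} {L} k≢cr

    covers-classReps : ∀ L k → covers (classReps L) k ≡ covers L k
    covers-classReps []      k = refl
    covers-classReps (r ∷ L) k with covers (classReps L) (c r) in e
    ... | true  = trans (covers-classReps L k)
                        (sym (covers-∷ r L (trans (sym (covers-classReps L (c r))) e) k))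
    ... | false = cong (does (k ℕ.≟ c r) ∨_) (covers-classReps L k)

    ∈⇒covers : ∀ {x L} → x ∈ L → covers L (c x) ≡ true
    ∈⇒covers {x} {_ ∷ L} (here refl) = covers-∷-≡ {x} {L} refl
    ∈⇒covers {x} {y ∷ L} (there x∈L) =
      trans (cong (does (c x ℕ.≟ c y) ∨_) (∈⇒covers x∈L)) (∨-zeroʳ _)

    ∑-classReps : ∀ {f} → InSpan G c f → ∀ L x →
      ∑ (classReps L) (λ r → f r * basicSum G c r x) ≡ (if covers L (c x) then f x else + 0)
    ∑-classReps f-span []      x = refl
    ∑-classReps {f} f-span (r ∷ L) x with covers (classReps L) (c r) in e
    ... | true  = trans (∑-classReps f-span L x) (cong (λ b → if b then f x else + 0)
                    (sym (covers-∷ r L (trans (sym (covers-classReps L (c r))) e) (c x))))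
    ... | false with c x ℕ.≟ c r
    ...   | yes cx≡cr = begin
      f r * basicSum G c r x + ∑ (classReps L) (λ r → f r * basicSum G c r x)
        ≡⟨ cong₂ _+_ (trans (cong (f r *_) (basicSum-≡ {r} {x} cx≡cr)) (ℤ.*-identityʳ (f r)))
                     (∑-classReps f-span L x) ⟩
      f r + (if covers L (c x) then f x else + 0)
        ≡⟨ cong (λ b → f r + (if b then f x else + 0))
             (trans (cong (covers L) cx≡cr) (trans (sym (covers-classReps L (c r))) e)) ⟩
      f r + + 0                                    ≡⟨ ℤ.+-identityʳ (f r) ⟩
      f r                                          ≡⟨ f-span r x (sym cx≡cr) ⟩
      f x
        ≡⟨ cong (λ b → if b then f x else + 0) (covers-∷-≡ {r} {L} cx≡cr) ⟨
      (if covers (r ∷ L) (c x) then f x else + 0)  ∎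
      where open ≡-Reasoning
    ...   | no cx≢cr = begin
      f r * basicSum G c r x + ∑ (classReps L) (λ r → f r * basicSum G c r x)
        ≡⟨ cong₂ _+_ (trans (cong (f r *_) (basicSum-≢ {r} {x} cx≢cr)) (ℤ.*-zeroʳ (f r)))
                     (∑-classReps f-span L x) ⟩
      + 0 + (if covers L (c x) then f x else + 0)  ≡⟨ ℤ.+-identityˡ _ ⟩
      (if covers L (c x) then f x else + 0)
        ≡⟨ cong (λ b → if b then f x else + 0) (covers-∷-≢ {r} {L} cx≢cr) ⟨
      (if covers (r ∷ L) (c x) then f x else + 0)  ∎
      where open ≡-Reasoning

    span-expansion : ∀ {f} → InSpan G c f → ∀ x →
      f x ≡ ∑ (classReps elems) (λ r → f r * basicSum G c r x)
    span-expansion {f} f-span x = sym (trans (∑-classReps f-span elems x)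
      (cong (λ b → if b then f x else + 0) (∈⇒covers (∈-elems x))))

    InSpan-conv : IsSRing G c → ∀ {f g} → InSpan G c f → InSpan G c g → InSpan G c (conv G f g)
    InSpan-conv S {f} {g} f-span g-span x x′ cx≡cx′ =
      trans (expand x) (trans (∑-cong reps (λ r → ∑-cong reps (λ s →
        cong ((f r * g s) *_) (IsSRing.mul-closed S r s x x′ cx≡cx′)))) (sym (expand x′)))
      where
      reps = classReps elems
      B = basicSum G c
      expand : ∀ x → conv G f g x ≡ ∑ reps (λ r → ∑ reps (λ s → (f r * g s) * conv G (B r) (B s) x))
      expand x = begin
        ∑ elems (λ a → f a * g (inv a · x))
          ≡⟨ ∑-cong elems (λ a → cong₂ _*_ (span-expansion f-span a)
                                            (span-expansion g-span (inv a · x))) ⟩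
        ∑ elems (λ a → ∑ reps (λ r → f r * B r a) * ∑ reps (λ s → g s * B s (inv a · x)))
          ≡⟨ ∑-cong elems (λ a → ∑-*-∑ reps reps _ _) ⟩
        ∑ elems (λ a → ∑ reps (λ r → ∑ reps (λ s → (f r * B r a) * (g s * B s (inv a · x)))))
          ≡⟨ ∑-comm elems reps _ ⟩
        ∑ reps (λ r → ∑ elems (λ a → ∑ reps (λ s → (f r * B r a) * (g s * B s (inv a · x)))))
          ≡⟨ ∑-cong reps (λ r → ∑-comm elems reps _) ⟩
        ∑ reps (λ r → ∑ reps (λ s → ∑ elems (λ a → (f r * B r a) * (g s * B s (inv a · x)))))
          ≡⟨ ∑-cong reps (λ r → ∑-cong reps (λ s → ∑-cong elems (λ a →
               *-interchange (f r) (B r a) (g s) (B s (inv a · x))))) ⟩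
        ∑ reps (λ r → ∑ reps (λ s → ∑ elems (λ a → (f r * g s) * (B r a * B s (inv a · x)))))
          ≡⟨ ∑-cong reps (λ r → ∑-cong reps (λ s → sym (*-distribˡ-∑ (f r * g s) elems _))) ⟩
        ∑ reps (λ r → ∑ reps (λ s → (f r * g s) * conv G (B r) (B s) x)) ∎
        where open ≡-Reasoning

module ExtensionByZero
  {G H : FinGroup} (G-finite : IsFiniteGroup G) (H-finite : IsFiniteGroup H)
  (ι : FinGroup.Carrier H → FinGroup.Carrier G)
  (ι-· : ∀ p q → ι (FinGroup._·_ H p q) ≡ FinGroup._·_ G (ι p) (ι q))
  (ι-inv : ∀ p → ι (FinGroup.inv H p) ≡ FinGroup.inv G (ι p))
  (ι⁻¹ : FinGroup.Carrier G → Maybe (FinGroup.Carrier H))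
  (ι⁻¹-ι : ∀ p → ι⁻¹ (ι p) ≡ just p)
  (ι⁻¹-just : ∀ {g p} → ι⁻¹ g ≡ just p → g ≡ ι p)
  where

  open FinGroup G
  open IsFiniteGroup G-finite using (_≟_)
  open GroupRingProperties G-finite
  module H = FinGroup H
  module Hᶠ = IsFiniteGroup H-finite
  module Hᴿ = GroupRingProperties H-finite

  ext : ℤG H → ℤG G
  ext f g = maybe′ f (+ 0) (ι⁻¹ g)

  ι-injective : ∀ {p q} → ι p ≡ ι q → p ≡ q
  ι-injective {p} {q} ιp≡ιq =
    just-injective (trans (sym (ι⁻¹-ι p)) (trans (cong ι⁻¹ ιp≡ιq) (ι⁻¹-ι q)))

  ι⁻¹≡nothing⇒≢ι : ∀ {g} → ι⁻¹ g ≡ nothing → ∀ p → g ≢ ι p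
  ι⁻¹≡nothing⇒≢ι {g} ι⁻¹g≡nothing p refl with () ← trans (sym (ι⁻¹-ι p)) ι⁻¹g≡nothing

  ι⁻¹-translate : ∀ q h → ι⁻¹ (ι q · h) ≡ Maybe.map (q H.·_) (ι⁻¹ h)
  ι⁻¹-translate q h with ι⁻¹ h in e
  ... | just r = trans (cong (λ v → ι⁻¹ (ι q · v)) (ι⁻¹-just e))
                       (trans (cong ι⁻¹ (sym (ι-· q r))) (ι⁻¹-ι (q H.· r)))
  ... | nothing with ι⁻¹ (ι q · h) in e′
  ...   | nothing = refl
  ...   | just r  = ⊥-elim (ι⁻¹≡nothing⇒≢ι e (H.inv q H.· r) (begin
    h                          ≡⟨ \\-leftDividesʳ (ι q) h ⟨
    inv (ι q) · (ι q · h)      ≡⟨ cong₂ _·_ (sym (ι-inv q)) (ι⁻¹-just e′) ⟩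
    ι (H.inv q) · ι r          ≡⟨ ι-· (H.inv q) r ⟨
    ι (H.inv q H.· r)          ∎))
    where open ≡-Reasoning

  ι-e : ι H.e ≡ e
  ι-e = identityˡ-unique (ι H.e) (ι H.e)
          (trans (sym (ι-· H.e H.e)) (cong ι (IsGroup.identityˡ Hᶠ.isGroup H.e)))

  ι⁻¹-inv : ∀ g → ι⁻¹ (inv g) ≡ Maybe.map H.inv (ι⁻¹ g)
  ι⁻¹-inv g with ι⁻¹ g in e
  ... | just p  = trans (cong (λ v → ι⁻¹ (inv v)) (ι⁻¹-just e))
                        (trans (cong ι⁻¹ (sym (ι-inv p))) (ι⁻¹-ι (H.inv p)))
  ... | nothing with ι⁻¹ (inv g) in e′
  ...   | nothing = refl
  ...   | just q  = ⊥-elim (ι⁻¹≡nothing⇒≢ι e (H.inv q)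
                      (trans (sym (⁻¹-involutive g)) (trans (cong inv (ι⁻¹-just e′)) (sym (ι-inv q)))))

  ext-as-∑ : ∀ f g → ext f g ≡ ∑ H.elems (λ p → if does (g ≟ ι p) then f p else + 0)
  ext-as-∑ f g with ι⁻¹ g in e
  ... | just r  = sym (trans (∑-cong H.elems (λ p → cong (λ b → if b then f p else + 0)
                                                         (does-⇔ (g≡ιp⇔r≡p p) (g ≟ ι p) (r Hᶠ.≟ p))))
                             (Hᴿ.∑-δ′ r f))
    where
    g≡ιp⇔r≡p : ∀ p → g ≡ ι p ⇔ r ≡ p
    g≡ιp⇔r≡p p = mk⇔ (λ g≡ιp → ι-injective (trans (sym (ι⁻¹-just e)) g≡ιp)) (λ { refl → ι⁻¹-just e })
  ... | nothing = sym (trans (∑-cong H.elems (λ p → cong (λ b → if b then f p else + 0)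
                                                         (dec-false (g ≟ ι p) (ι⁻¹≡nothing⇒≢ι e p))))
                             (∑-zero H.elems))

  ext-* : ∀ f k g → ext f g * k ≡ ext (λ p → f p * k) g
  ext-* f k g with ι⁻¹ g
  ... | just p  = refl
  ... | nothing = ℤ.*-zeroˡ k

  ∑-ext : ∀ f (X : ℤG G) → ∑ elems (λ a → ext f a * X a) ≡ ∑ H.elems (λ p → f p * X (ι p))
  ∑-ext f X = begin
    ∑ elems (λ a → ext f a * X a)
      ≡⟨ ∑-cong elems (λ a → trans (ext-* f (X a) a) (ext-as-∑ _ a)) ⟩
    ∑ elems (λ a → ∑ H.elems (λ p → if does (a ≟ ι p) then f p * X a else + 0))
      ≡⟨ ∑-comm elems H.elems _ ⟩
    ∑ H.elems (λ p → ∑ elems (λ a → if does (a ≟ ι p) then f p * X a else + 0))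
      ≡⟨ ∑-cong H.elems (λ p → IsFiniteGroup.∑-δ G-finite (ι p) (λ a → f p * X a)) ⟩
    ∑ H.elems (λ p → f p * X (ι p)) ∎
    where open ≡-Reasoning

  ext-translate : ∀ g p h → ext g (inv (ι p) · h) ≡ maybe′ (λ r → g (H.inv p H.· r)) (+ 0) (ι⁻¹ h)
  ext-translate g p h = begin
    ext g (inv (ι p) · h)
      ≡⟨ cong (λ v → ext g (v · h)) (ι-inv p) ⟨
    maybe′ g (+ 0) (ι⁻¹ (ι (H.inv p) · h))
      ≡⟨ cong (maybe′ g (+ 0)) (ι⁻¹-translate (H.inv p) h) ⟩
    maybe′ g (+ 0) (Maybe.map (H.inv p H.·_) (ι⁻¹ h))
      ≡⟨ maybe′-map g (+ 0) (H.inv p H.·_) (ι⁻¹ h) ⟩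
    maybe′ (λ r → g (H.inv p H.· r)) (+ 0) (ι⁻¹ h) ∎
    where open ≡-Reasoning

  conv-ext : ∀ f g → conv G (ext f) (ext g) ≗ ext (conv H f g)
  conv-ext f g h = begin
    conv G (ext f) (ext g) h
      ≡⟨ ∑-ext f (λ a → ext g (inv a · h)) ⟩
    ∑ H.elems (λ p → f p * ext g (inv (ι p) · h))
      ≡⟨ ∑-cong H.elems (λ p → cong (f p *_) (ext-translate g p h)) ⟩
    ∑ H.elems (λ p → f p * maybe′ (λ r → g (H.inv p H.· r)) (+ 0) (ι⁻¹ h))
      ≡⟨ ∑-maybe (ι⁻¹ h) ⟩
    ext (conv H f g) h ∎
    where
    open ≡-Reasoning
    ∑-maybe : ∀ mr → ∑ H.elems (λ p → f p * maybe′ (λ r → g (H.inv p H.· r)) (+ 0) mr)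
                     ≡ maybe′ (conv H f g) (+ 0) mr
    ∑-maybe (just r) = refl
    ∑-maybe nothing  = trans (∑-cong H.elems (λ p → ℤ.*-zeroʳ (f p))) (∑-zero H.elems)

  conv-affine : ∀ α f β g → ∃ λ γ →
    conv G (const α +ᶠ ext f) (const β +ᶠ ext g) ≗ const γ +ᶠ ext (conv H f g)
  conv-affine α f β g = γ , λ h → begin
    conv G (const α +ᶠ ext f) (const β +ᶠ ext g) h
      ≡⟨ conv-distribʳ (const α) (ext f) (const β +ᶠ ext g) h ⟩
    conv G (const α) (const β +ᶠ ext g) h + conv G (ext f) (const β +ᶠ ext g) h
      ≡⟨ cong₂ _+_ (conv-distribˡ (const β) (ext g) (const α) h)
                   (conv-distribˡ (const β) (ext g) (ext f) h) ⟩
    (conv G (const α) (const β) h + conv G (const α) (ext g) h) +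
    (conv G (ext f) (const β) h + conv G (ext f) (ext g) h)
      ≡⟨ cong₂ _+_ (cong₂ _+_ (conv-constˡ α (const β) h) (conv-constˡ α (ext g) h))
                   (cong₂ _+_ (conv-constʳ (ext f) β h) (conv-ext f g h)) ⟩
    (α * ∑ elems (const β) + α * ∑ elems (ext g)) + (∑ elems (ext f) * β + ext (conv H f g) h)
      ≡⟨ ℤ.+-assoc (α * ∑ elems (const β) + α * ∑ elems (ext g)) (∑ elems (ext f) * β) (ext (conv H f g) h) ⟨
    γ + ext (conv H f g) h ∎
    where
    open ≡-Reasoning
    γ = α * ∑ elems (const β) + α * ∑ elems (ext g) + ∑ elems (ext f) * β

  affine-decomposition : ∀ (F : Maybe H.Carrier → ℤ) →
    (λ g → F (ι⁻¹ g)) ≗ const (F nothing) +ᶠ ext (λ q → F (just q) - F nothing)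
  affine-decomposition F g with ι⁻¹ g
  ... | nothing = sym (ℤ.+-identityʳ (F nothing))
  ... | just q  = sym (m+[n-m]≡n (F nothing) (F (just q)))
    where
    m+[n-m]≡n : ∀ a b → a + (b - a) ≡ b
    m+[n-m]≡n = solve 2 (λ a b → a :+ (b :- a) := b) refl
      where open +-*-Solver

  ext-vanishing : ∀ (F : Maybe H.Carrier → ℤ) → F nothing ≡ + 0 →
                  (λ g → F (ι⁻¹ g)) ≗ ext (λ q → F (just q))
  ext-vanishing F F₀ g with ι⁻¹ g
  ... | nothing = F₀
  ... | just q  = refl

  -- The basic sets of c₀, transported by ι, together with G ∖ ι H, which is labelled N.
  module AdjoinComplement
    (c₀ : H.Carrier → ℕ) (c₀-isSRing : IsSRing H c₀) (N : ℕ) (c₀≢N : ∀ p → c₀ p ≢ N)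
    where

    extend : Carrier → ℕ
    extend g = maybe′ c₀ N (ι⁻¹ g)

    extend-ι : ∀ p → extend (ι p) ≡ c₀ p
    extend-ι p = cong (maybe′ c₀ N) (ι⁻¹-ι p)

    ext-respects : ∀ {f} → InSpan H c₀ f → ∀ g h → extend g ≡ extend h → ext f g ≡ ext f h
    ext-respects {f} f-span g h eq with ι⁻¹ g | ι⁻¹ h
    ... | nothing | nothing = refl
    ... | just p  | just q  = f-span p q eq
    ... | just p  | nothing = ⊥-elim (c₀≢N p eq)
    ... | nothing | just q  = ⊥-elim (c₀≢N q (sym eq))

    extend-isSRing : IsSRing G extend
    extend-isSRing = record
      { singleton-e = singleton-e
      ; inv-closed  = inv-closed
      ; mul-closed  = mul-closed
      }
      where
      open IsSRing c₀-isSRing using () renaming (singleton-e to singleton-e₀; inv-closed to inv-closed₀)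

      singleton-e : ∀ g → extend g ≡ extend e → g ≡ e
      singleton-e g eq with ι⁻¹ g in ι⁻¹g
      ... | nothing = ⊥-elim (c₀≢N H.e (sym (trans eq (trans (cong extend (sym ι-e)) (extend-ι H.e)))))
      ... | just p  = trans (ι⁻¹-just ι⁻¹g) (trans (cong ι (singleton-e₀ p
                        (trans eq (trans (cong extend (sym ι-e)) (extend-ι H.e))))) ι-e)

      extend-inv : ∀ g → extend (inv g) ≡ maybe′ (λ p → c₀ (H.inv p)) N (ι⁻¹ g)
      extend-inv g = trans (cong (maybe′ c₀ N) (ι⁻¹-inv g)) (maybe′-map c₀ N H.inv (ι⁻¹ g))

      inv-closed : ∀ g h → extend g ≡ extend h → extend (inv g) ≡ extend (inv h)
      inv-closed g h eq = trans (extend-inv g) (trans (inverted (ι⁻¹ g) (ι⁻¹ h) eq) (sym (extend-inv h)))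
        where
        inverted : ∀ mp mq → maybe′ c₀ N mp ≡ maybe′ c₀ N mq →
                   maybe′ (λ p → c₀ (H.inv p)) N mp ≡ maybe′ (λ p → c₀ (H.inv p)) N mq
        inverted nothing  nothing  _  = refl
        inverted (just p) (just q) eq = inv-closed₀ p q eq
        inverted (just p) nothing  eq = ⊥-elim (c₀≢N p eq)
        inverted nothing  (just q) eq = ⊥-elim (c₀≢N q (sym eq))

      -- Basic sums are constant off ι H, hence so is their product, whose H-part is a product
      -- of class functions of c₀.
      mul-closed : ∀ a b → InSpan G extend (conv G (basicSum G extend a) (basicSum G extend b))
      mul-closed a b g h eq = begin
        conv G (basicSum G extend a) (basicSum G extend b) g  ≡⟨ affine g ⟩
        γ + ext (conv H (trace a) (trace b)) g
          ≡⟨ cong (_+_ γ) (ext-respects product-span g h eq) ⟩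
        γ + ext (conv H (trace a) (trace b)) h                ≡⟨ affine h ⟨
        conv G (basicSum G extend a) (basicSum G extend b) h  ∎
        where
        open ≡-Reasoning
        indicator : Carrier → Maybe H.Carrier → ℤ
        indicator a md = if does (maybe′ c₀ N md ℕ.≟ extend a) then + 1 else + 0
        trace : Carrier → ℤG H
        trace a q = indicator a (just q) - indicator a nothing
        trace-span : ∀ a → InSpan H c₀ (trace a)
        trace-span a p q c₀p≡c₀q =
          cong (λ k → (if does (k ℕ.≟ extend a) then + 1 else + 0) - indicator a nothing) c₀p≡c₀q
        product-span : InSpan H c₀ (conv H (trace a) (trace b))
        product-span = Hᴿ.InSpan-conv c₀ c₀-isSRing (trace-span a) (trace-span b)
        γ : ℤ
        γ = proj₁ (conv-affine (indicator a nothing) (trace a) (indicator b nothing) (trace b))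
        affine : ∀ g → conv G (basicSum G extend a) (basicSum G extend b) g ≡
                       γ + ext (conv H (trace a) (trace b)) g
        affine g = trans (conv-cong (affine-decomposition (indicator a)) (affine-decomposition (indicator b)) g)
                         (proj₂ (conv-affine (indicator a nothing) (trace a) (indicator b nothing) (trace b)) g)

module DihedralGroup (n : ℕ) .{{_ : NonZero n}} where
  open Dihedral n

  0ₙ : Fin n
  0ₙ = 0 mod n

  toℕ-mod : ∀ k → toℕ (k mod n) ≡ k % n
  toℕ-mod k = toℕ-fromℕ< (m%n<n k n)

  toℕ-0ₙ : toℕ 0ₙ ≡ 0
  toℕ-0ₙ = trans (toℕ-mod 0) (m<n⇒m%n≡m (ℕ.>-nonZero⁻¹ n))

  [m%n+o]%n≡[m+o]%n : ∀ a b → (a % n ℕ.+ b) % n ≡ (a ℕ.+ b) % n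
  [m%n+o]%n≡[m+o]%n a b = begin
    (a % n ℕ.+ b) % n           ≡⟨ %-distribˡ-+ (a % n) b n ⟩
    (a % n % n ℕ.+ b % n) % n   ≡⟨ cong (λ v → (v ℕ.+ b % n) % n) (m%n%n≡m%n a n) ⟩
    (a % n ℕ.+ b % n) % n       ≡⟨ %-distribˡ-+ a b n ⟨
    (a ℕ.+ b) % n               ∎
    where open ≡-Reasoning

  [m+o%n]%n≡[m+o]%n : ∀ a b → (a ℕ.+ b % n) % n ≡ (a ℕ.+ b) % n
  [m+o%n]%n≡[m+o]%n a b = begin
    (a ℕ.+ b % n) % n ≡⟨ cong (_% n) (ℕ.+-comm a (b % n)) ⟩
    (b % n ℕ.+ a) % n ≡⟨ [m%n+o]%n≡[m+o]%n b a ⟩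
    (b ℕ.+ a) % n     ≡⟨ cong (_% n) (ℕ.+-comm b a) ⟩
    (a ℕ.+ b) % n     ∎
    where open ≡-Reasoning

  addF-assoc : ∀ i j k → addF (addF i j) k ≡ addF i (addF j k)
  addF-assoc i j k = toℕ-injective (begin
    toℕ (addF (addF i j) k)                   ≡⟨ toℕ-mod _ ⟩
    (toℕ (addF i j) ℕ.+ toℕ k) % n            ≡⟨ cong (λ v → (v ℕ.+ toℕ k) % n) (toℕ-mod _) ⟩
    ((toℕ i ℕ.+ toℕ j) % n ℕ.+ toℕ k) % n     ≡⟨ [m%n+o]%n≡[m+o]%n _ _ ⟩
    (toℕ i ℕ.+ toℕ j ℕ.+ toℕ k) % n           ≡⟨ cong (_% n) (ℕ.+-assoc (toℕ i) _ _) ⟩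
    (toℕ i ℕ.+ (toℕ j ℕ.+ toℕ k)) % n         ≡⟨ [m+o%n]%n≡[m+o]%n _ _ ⟨
    (toℕ i ℕ.+ (toℕ j ℕ.+ toℕ k) % n) % n     ≡⟨ cong (λ v → (toℕ i ℕ.+ v) % n) (toℕ-mod _) ⟨
    (toℕ i ℕ.+ toℕ (addF j k)) % n            ≡⟨ toℕ-mod _ ⟨
    toℕ (addF i (addF j k))                   ∎)
    where open ≡-Reasoning

  addF-comm : ∀ i j → addF i j ≡ addF j i
  addF-comm i j = cong (_mod n) (ℕ.+-comm (toℕ i) (toℕ j))

  addF-identityˡ : ∀ i → addF 0ₙ i ≡ i
  addF-identityˡ i = toℕ-injective (begin
    toℕ (addF 0ₙ i)            ≡⟨ toℕ-mod _ ⟩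
    (toℕ 0ₙ ℕ.+ toℕ i) % n     ≡⟨ cong (λ v → (v ℕ.+ toℕ i) % n) toℕ-0ₙ ⟩
    toℕ i % n                  ≡⟨ m<n⇒m%n≡m (toℕ<n i) ⟩
    toℕ i                      ∎)
    where open ≡-Reasoning

  negF-inverseˡ : ∀ i → addF (negF i) i ≡ 0ₙ
  negF-inverseˡ i = toℕ-injective (begin
    toℕ (addF (negF i) i)                   ≡⟨ toℕ-mod _ ⟩
    (toℕ (negF i) ℕ.+ toℕ i) % n            ≡⟨ cong (λ v → (v ℕ.+ toℕ i) % n) (toℕ-mod _) ⟩
    ((n ℕ.∸ toℕ i) % n ℕ.+ toℕ i) % n       ≡⟨ [m%n+o]%n≡[m+o]%n _ _ ⟩
    (n ℕ.∸ toℕ i ℕ.+ toℕ i) % n             ≡⟨ cong (_% n) (ℕ.m∸n+n≡m (ℕ.<⇒≤ (toℕ<n i))) ⟩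
    n % n                                   ≡⟨ n%n≡0 n ⟩
    0                                       ≡⟨ toℕ-0ₙ ⟨
    toℕ 0ₙ                                  ∎)
    where open ≡-Reasoning

  addF-isAbelianGroup : IsAbelianGroup _≡_ addF 0ₙ negF
  addF-isAbelianGroup = record
    { isGroup = record
      { isMonoid = record
        { isSemigroup = record
          { isMagma = record { isEquivalence = isEquivalence ; ∙-cong = cong₂ addF }
          ; assoc   = addF-assoc }
        ; identity = addF-identityˡ , λ i → trans (addF-comm i 0ₙ) (addF-identityˡ i) }
      ; inverse = negF-inverseˡ , λ i → trans (addF-comm i (negF i)) (negF-inverseˡ i)
      ; ⁻¹-cong = cong negF }
    ; comm = addF-comm }

  ℤ/nℤ : AbelianGroup 0ℓ 0ℓ
  ℤ/nℤ = record { isAbelianGroup = addF-isAbelianGroup }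

  open AbelianGroup ℤ/nℤ using () renaming (identityʳ to addF-identityʳ; inverseʳ to negF-inverseʳ)
  open import Algebra.Properties.AbelianGroup ℤ/nℤ using (⁻¹-∙-comm; ⁻¹-involutive; ε⁻¹≈ε)

  sign : Bool → Fin n → Fin n
  sign b i = if b then negF i else i

  sign-addF : ∀ b i j → sign b (addF i j) ≡ addF (sign b i) (sign b j)
  sign-addF false i j = refl
  sign-addF true  i j = sym (⁻¹-∙-comm i j)

  sign-sign : ∀ b c i → sign c (sign b i) ≡ sign (b xor c) i
  sign-sign false c     i = refl
  sign-sign true  false i = refl
  sign-sign true  true  i = ⁻¹-involutive i

  mul-assoc : ∀ p q r → mul (mul p q) r ≡ mul p (mul q r)
  mul-assoc (a , i) (b , j) (c , k) = cong₂ _,_ (xor-assoc a b c) (begin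
    addF (sign c (addF (sign b i) j)) k                 ≡⟨ cong (λ v → addF v k) (sign-addF c _ _) ⟩
    addF (addF (sign c (sign b i)) (sign c j)) k        ≡⟨ cong (λ v → addF (addF v (sign c j)) k) (sign-sign b c i) ⟩
    addF (addF (sign (b xor c) i) (sign c j)) k         ≡⟨ addF-assoc _ _ _ ⟩
    addF (sign (b xor c) i) (addF (sign c j) k)         ∎)
    where open ≡-Reasoning

  mul-identityˡ : ∀ p → mul one p ≡ p
  mul-identityˡ (b , j) = cong (b ,_) (trans (cong (λ v → addF v j) (sign-0ₙ b)) (addF-identityˡ j))
    where
    sign-0ₙ : ∀ b → sign b 0ₙ ≡ 0ₙ
    sign-0ₙ false = refl
    sign-0ₙ true  = ε⁻¹≈ε

  mul-identityʳ : ∀ p → mul p one ≡ p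
  mul-identityʳ (false , i) = cong (false ,_) (addF-identityʳ i)
  mul-identityʳ (true  , i) = cong (true ,_) (addF-identityʳ i)

  mul-inverseˡ : ∀ p → mul (invD p) p ≡ one
  mul-inverseˡ (false , i) = cong (false ,_) (negF-inverseˡ i)
  mul-inverseˡ (true  , i) = cong (false ,_) (negF-inverseˡ i)

  mul-inverseʳ : ∀ p → mul p (invD p) ≡ one
  mul-inverseʳ (false , i) = cong (false ,_) (negF-inverseʳ i)
  mul-inverseʳ (true  , i) = cong (false ,_) (negF-inverseˡ i)

  mul-isGroup : IsGroup _≡_ mul one invD
  mul-isGroup = record
    { isMonoid = record
      { isSemigroup = record
        { isMagma = record { isEquivalence = isEquivalence ; ∙-cong = cong₂ mul }
        ; assoc   = mul-assoc }
      ; identity = mul-identityˡ , mul-identityʳ }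
    ; inverse = mul-inverseˡ , mul-inverseʳ
    ; ⁻¹-cong = cong invD }

  _≟_ : DecidableEquality Elt
  _≟_ = ≡-dec Bool._≟_ Fin._≟_

  ∈-elems : ∀ g → g ∈ FinGroup.elems D
  ∈-elems (false , i) = ∈-++⁺ˡ (∈-map⁺ (false ,_) (∈-toList⁺ (∈-allFin⁺ i)))
  ∈-elems (true  , i) =
    ∈-++⁺ʳ (map (false ,_) (toList (allFin n))) (∈-++⁺ˡ (∈-map⁺ (true ,_) (∈-toList⁺ (∈-allFin⁺ i))))

  ∑-elems : ∀ f → ∑ (FinGroup.elems D) f ≡
            ∑ (toList (allFin n)) (λ i → f (false , i)) + ∑ (toList (allFin n)) (λ i → f (true , i))
  ∑-elems f = begin
    ∑ (L₀ ++ L₁ ++ []) f        ≡⟨ ∑-++ L₀ (L₁ ++ []) f ⟩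
    ∑ L₀ f + ∑ (L₁ ++ []) f     ≡⟨ cong (_+_ (∑ L₀ f)) (trans (∑-++ L₁ [] f) (ℤ.+-identityʳ _)) ⟩
    ∑ L₀ f + ∑ L₁ f             ≡⟨ cong₂ _+_ (∑-map (false ,_) L f) (∑-map (true ,_) L f) ⟩
    ∑ L (λ i → f (false , i)) + ∑ L (λ i → f (true , i)) ∎
    where
    open ≡-Reasoning
    L  = toList (allFin n)
    L₀ = map (false ,_) L
    L₁ = map (true ,_) L

  -- does ((b , i) ≟ (b′ , j)) computes to does (i ≟ j) if b = b′ and to false otherwise.
  ∑-δ : ∀ t (ψ : Elt → ℤ) → ∑ (FinGroup.elems D) (λ a → if does (a ≟ t) then ψ a else + 0) ≡ ψ t
  ∑-δ (false , j) ψ = trans (∑-elems _)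
    (trans (cong₂ _+_ (∑-allFin-δ j (λ i → ψ (false , i))) (∑-zero (toList (allFin n)))) (ℤ.+-identityʳ _))
  ∑-δ (true , j) ψ = trans (∑-elems _)
    (trans (cong₂ _+_ (∑-zero (toList (allFin n))) (∑-allFin-δ j (λ i → ψ (true , i)))) (ℤ.+-identityˡ _))

  D-isFiniteGroup : IsFiniteGroup D
  D-isFiniteGroup = record
    { isGroup = mul-isGroup ; _≟_ = _≟_ ; ∈-elems = ∈-elems ; ∑-δ = ∑-δ }

module D₄ where
  open Dihedral 4 public
  open DihedralGroup 4 public
  open GroupRingProperties D-isFiniteGroup public

-- (b , i) stands for yᵇx₀ⁱ ∈ G₀ (see ι below), and class₄ gives the index of its Yᵢ.
class₄ : D₄.Elt → Fin 5
class₄ (false , 0F) = 0F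
class₄ (true , 2F)  = 1F
class₄ (true , 0F)  = 2F
class₄ (false , 1F) = 2F
class₄ (false , 3F) = 2F
class₄ (false , 2F) = 3F
class₄ (true , 1F)  = 3F
class₄ (true , 3F)  = 3F

label₄ : D₄.Elt → ℕ
label₄ p = toℕ (class₄ p)

label₄≢4 : ∀ p → label₄ p ≢ 4
label₄≢4 = toWitness {a? = D₄.∀? λ p → ¬? (label₄ p ℕ.≟ 4)} _

label₄-isSRing : IsSRing D₄.D label₄
label₄-isSRing = record
  { singleton-e = toWitness {a? = D₄.∀? λ g →
                    (label₄ g ℕ.≟ label₄ D₄.one) →-dec (g D₄.≟ D₄.one)} _
  ; inv-closed  = toWitness {a? = D₄.∀? λ g → D₄.∀? λ h →
                    (label₄ g ℕ.≟ label₄ h) →-dec (label₄ (D₄.invD g) ℕ.≟ label₄ (D₄.invD h))} _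
  ; mul-closed  = toWitness {a? = D₄.∀? λ a → D₄.∀? λ b → D₄.∀? λ g → D₄.∀? λ h →
                    (label₄ g ℕ.≟ label₄ h) →-dec
                    (conv D₄.D (basicSum D₄.D label₄ a) (basicSum D₄.D label₄ b) g ℤ.≟
                     conv D₄.D (basicSum D₄.D label₄ a) (basicSum D₄.D label₄ b) h)} _
  }

-- Functions on Maybe D₄ stand for functions on G constant on G ∖ G₀, which nothing represents.
classᴹ : Maybe D₄.Elt → Fin 5
classᴹ = maybe′ class₄ (Fin.fromℕ 4)

labelᴹ : Maybe D₄.Elt → ℕ
labelᴹ = maybe′ label₄ 4

inR : Fin 5 → Bool
inR 1F = true
inR 3F = true
inR 4F = true
inR _  = false

indᴹ : ℕ → Maybe D₄.Elt → ℤ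
indᴹ k md = if does (labelᴹ md ℕ.≟ k) then + 1 else + 0

convᴹ : ℕ → ℕ → Maybe D₄.Elt → ℤ
convᴹ k l = maybe′ (conv D₄.D (indᴹ k ∘ just) (indᴹ l ∘ just)) (+ 0)

∀ᴹ? : {P : Maybe D₄.Elt → Set} → Decidable P → Dec (∀ md → P md)
∀ᴹ? P? = map′ (λ (Pn , Pj) → maybe Pj Pn) (λ ∀P → ∀P nothing , ∀P ∘ just)
              (P? nothing ×-dec D₄.∀? (P? ∘ just))

Determines : {S T : Set} → (Maybe D₄.Elt → S) → (Maybe D₄.Elt → T) → Set
Determines s t = ∀ md md′ → s md ≡ s md′ → t md ≡ t md′

-- Successively finer invariants of g respected by every S-ring in which R is a union of
-- basic sets: whether g = e, whether g ∈ R, and the coefficients of g in Y₂Y₂ and Y₂Y₃.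
σ₁ : Maybe D₄.Elt → Bool × Bool
σ₁ md = does (labelᴹ md ℕ.≟ 0) , inR (classᴹ md)

σ₂ : Maybe D₄.Elt → (Bool × Bool) × ℤ
σ₂ md = σ₁ md , convᴹ 2 2 md

σ₃ : Maybe D₄.Elt → ((Bool × Bool) × ℤ) × ℤ
σ₃ md = σ₂ md , convᴹ 2 3 md

_≟₁_ : DecidableEquality (Bool × Bool)
_≟₁_ = ≡-dec Bool._≟_ Bool._≟_

_≟₂_ : DecidableEquality ((Bool × Bool) × ℤ)
_≟₂_ = ≡-dec _≟₁_ ℤ._≟_

_≟₃_ : DecidableEquality (((Bool × Bool) × ℤ) × ℤ)
_≟₃_ = ≡-dec _≟₂_ ℤ._≟_

σ₁-determines-Y₂ : Determines σ₁ (indᴹ 2)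
σ₁-determines-Y₂ = toWitness {a? = ∀ᴹ? λ md → ∀ᴹ? λ md′ →
                     (σ₁ md ≟₁ σ₁ md′) →-dec (indᴹ 2 md ℤ.≟ indᴹ 2 md′)} _

σ₂-determines-Y₃ : Determines σ₂ (indᴹ 3)
σ₂-determines-Y₃ = toWitness {a? = ∀ᴹ? λ md → ∀ᴹ? λ md′ →
                     (σ₂ md ≟₂ σ₂ md′) →-dec (indᴹ 3 md ℤ.≟ indᴹ 3 md′)} _

σ₃-determines-label : Determines σ₃ labelᴹ
σ₃-determines-label = toWitness {a? = ∀ᴹ? λ md → ∀ᴹ? λ md′ →
                        (σ₃ md ≟₃ σ₃ md′) →-dec (labelᴹ md ℕ.≟ labelᴹ md′)} _

module Embedding (m : ℕ) .{{_ : NonZero m}} where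
  open Setting m
  open DihedralGroup n using (toℕ-mod; ℤ/nℤ; mul-identityʳ)

  -- x₀ᵃ = x^(ψ a), so ι below maps D₄ onto G₀ = ⟨x₀, y⟩.
  ψ : ℕ → Fin n
  ψ a = (a ℕ.* m) mod n

  toℕ-ψ : ∀ a → toℕ (ψ a) ≡ (a % 4) ℕ.* m
  toℕ-ψ a = trans (toℕ-mod (a ℕ.* m)) (sym (m%n*o≡m*o%[n*o] a 4 m))

  toℕ-ψ₄ : ∀ (k : Fin 4) → toℕ (ψ (toℕ k)) ≡ toℕ k ℕ.* m
  toℕ-ψ₄ k = trans (toℕ-ψ (toℕ k)) (cong (ℕ._* m) (m<n⇒m%n≡m (toℕ<n k)))

  ψ-cong : ∀ {a b} → a % 4 ≡ b % 4 → ψ a ≡ ψ b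
  ψ-cong {a} {b} eq = toℕ-injective (trans (toℕ-ψ a) (trans (cong (ℕ._* m) eq) (sym (toℕ-ψ b))))

  ψ-+ : ∀ a b → ψ (a ℕ.+ b) ≡ addF (ψ a) (ψ b)
  ψ-+ a b = toℕ-injective (begin
    toℕ (ψ (a ℕ.+ b))                           ≡⟨ toℕ-mod _ ⟩
    ((a ℕ.+ b) ℕ.* m) % n                       ≡⟨ cong (_% n) (ℕ.*-distribʳ-+ m a b) ⟩
    (a ℕ.* m ℕ.+ b ℕ.* m) % n                   ≡⟨ %-distribˡ-+ (a ℕ.* m) (b ℕ.* m) n ⟩
    ((a ℕ.* m) % n ℕ.+ (b ℕ.* m) % n) % n       ≡⟨ cong₂ (λ u v → (u ℕ.+ v) % n) (toℕ-mod _) (toℕ-mod _) ⟨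
    (toℕ (ψ a) ℕ.+ toℕ (ψ b)) % n               ≡⟨ toℕ-mod _ ⟨
    toℕ (addF (ψ a) (ψ b))                      ∎)
    where open ≡-Reasoning

  ψ-addF₄ : ∀ i j → ψ (toℕ (D₄.addF i j)) ≡ addF (ψ (toℕ i)) (ψ (toℕ j))
  ψ-addF₄ i j = trans (ψ-cong {toℕ (D₄.addF i j)} {toℕ i ℕ.+ toℕ j} mod4) (ψ-+ (toℕ i) (toℕ j))
    where
    mod4 : toℕ (D₄.addF i j) % 4 ≡ (toℕ i ℕ.+ toℕ j) % 4
    mod4 = trans (cong (_% 4) (D₄.toℕ-mod (toℕ i ℕ.+ toℕ j))) (m%n%n≡m%n (toℕ i ℕ.+ toℕ j) 4)

  ψ-negF₄ : ∀ i → ψ (toℕ (D₄.negF i)) ≡ negF (ψ (toℕ i))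
  ψ-negF₄ i = inverseˡ-unique (ψ (toℕ (D₄.negF i))) (ψ (toℕ i))
    (trans (sym (ψ-addF₄ (D₄.negF i) i)) (cong (λ k → ψ (toℕ k)) (D₄.negF-inverseˡ i)))
    where open import Algebra.Properties.Group (AbelianGroup.group ℤ/nℤ) using (inverseˡ-unique)

  ι : D₄.Elt → Elt
  ι (b , k) = (b , ψ (toℕ k))

  ι-mul : ∀ p q → ι (D₄.mul p q) ≡ ι p · ι q
  ι-mul (a , i) (false , j) = cong (a xor false ,_) (ψ-addF₄ i j)
  ι-mul (a , i) (true  , j) = cong (a xor true ,_)
    (trans (ψ-addF₄ (D₄.negF i) j) (cong (λ v → addF v (ψ (toℕ j))) (ψ-negF₄ i)))

  ι-inv : ∀ p → ι (D₄.invD p) ≡ invD (ι p)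
  ι-inv (false , i) = cong (false ,_) (ψ-negF₄ i)
  ι-inv (true  , i) = refl

  ψ⁻¹ : Fin n → Maybe (Fin 4)
  ψ⁻¹ i with toℕ i % m ℕ.≟ 0
  ... | yes _ = just ((toℕ i / m) mod 4)
  ... | no  _ = nothing

  ψ⁻¹-ψ : ∀ k → ψ⁻¹ (ψ (toℕ k)) ≡ just k
  ψ⁻¹-ψ k with toℕ (ψ (toℕ k)) % m ℕ.≟ 0
  ... | yes _ = cong just (toℕ-injective (begin
    toℕ ((toℕ (ψ (toℕ k)) / m) mod 4)   ≡⟨ D₄.toℕ-mod (toℕ (ψ (toℕ k)) / m) ⟩
    (toℕ (ψ (toℕ k)) / m) % 4           ≡⟨ cong (λ v → v / m % 4) (toℕ-ψ₄ k) ⟩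
    (toℕ k ℕ.* m / m) % 4               ≡⟨ cong (_% 4) (m*n/n≡m (toℕ k) m) ⟩
    toℕ k % 4                           ≡⟨ m<n⇒m%n≡m (toℕ<n k) ⟩
    toℕ k                               ∎))
    where open ≡-Reasoning
  ... | no ¬k*m%m≡0 = ⊥-elim (¬k*m%m≡0 (trans (cong (_% m) (toℕ-ψ₄ k)) (m*n%n≡0 (toℕ k) m)))

  ψ⁻¹-just : ∀ {i k} → ψ⁻¹ i ≡ just k → i ≡ ψ (toℕ k)
  ψ⁻¹-just {i} eq with toℕ i % m ℕ.≟ 0
  ψ⁻¹-just {i} refl | yes i%m≡0 = toℕ-injective (sym (begin
    toℕ (ψ (toℕ ((toℕ i / m) mod 4)))          ≡⟨ toℕ-ψ₄ ((toℕ i / m) mod 4) ⟩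
    toℕ ((toℕ i / m) mod 4) ℕ.* m              ≡⟨ cong (ℕ._* m) (D₄.toℕ-mod (toℕ i / m)) ⟩
    (toℕ i / m) % 4 ℕ.* m                      ≡⟨ cong (ℕ._* m) (m<n⇒m%n≡m (m<n*o⇒m/o<n {n = 4} (toℕ<n i))) ⟩
    (toℕ i / m) ℕ.* m                          ≡⟨ cong (ℕ._+ (toℕ i / m) ℕ.* m) i%m≡0 ⟨
    toℕ i % m ℕ.+ (toℕ i / m) ℕ.* m            ≡⟨ m≡m%n+[m/n]*n (toℕ i) m ⟨
    toℕ i                                      ∎))
    where open ≡-Reasoning

  ι⁻¹ : Elt → Maybe D₄.Elt
  ι⁻¹ (b , i) = Maybe.map (b ,_) (ψ⁻¹ i)

  ι⁻¹-ι : ∀ p → ι⁻¹ (ι p) ≡ just p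
  ι⁻¹-ι (b , k) = cong (Maybe.map (b ,_)) (ψ⁻¹-ψ k)

  ι⁻¹-just : ∀ {g p} → ι⁻¹ g ≡ just p → g ≡ ι p
  ι⁻¹-just {b , i} eq with ψ⁻¹ i in ψ⁻¹i
  ι⁻¹-just {b , i} refl | just k = cong (b ,_) (ψ⁻¹-just ψ⁻¹i)

  x⁻ᵏy≡yxᵏ : ∀ k → D₄.mul (false , D₄.negF k) D₄.y ≡ (true , k)
  x⁻ᵏy≡yxᵏ 0F = refl
  x⁻ᵏy≡yxᵏ 1F = refl
  x⁻ᵏy≡yxᵏ 2F = refl
  x⁻ᵏy≡yxᵏ 3F = refl

  ψ-mod : ∀ k → ψ (toℕ (k mod 4)) ≡ ψ k
  ψ-mod k = ψ-cong {toℕ (k mod 4)} {k} (trans (cong (_% 4) (D₄.toℕ-mod k)) (m%n%n≡m%n k 4))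

  InG₀⇒∈image : ∀ {g} → InG₀ g → ∃ λ p → g ≡ ι p
  InG₀⇒∈image (_ , _ , (k , refl) , inj₁ refl , refl) =
    D₄.mul (false , k mod 4) D₄.one ,
    trans (cong (λ v → (false , v) · one) (sym (ψ-mod k))) (sym (ι-mul (false , k mod 4) D₄.one))
  InG₀⇒∈image (_ , _ , (k , refl) , inj₂ refl , refl) =
    D₄.mul (false , k mod 4) D₄.y ,
    trans (cong (λ v → (false , v) · y) (sym (ψ-mod k))) (sym (ι-mul (false , k mod 4) D₄.y))

  ι-InG₀ : ∀ p → InG₀ (ι p)
  ι-InG₀ (false , k) = (false , ψ (toℕ k)) , one , (toℕ k , refl) , inj₁ refl , sym (mul-identityʳ _)
  ι-InG₀ (true  , k) = (false , ψ (toℕ (D₄.negF k))) , y , (toℕ (D₄.negF k) , refl) , inj₂ refl ,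
    trans (cong ι (sym (x⁻ᵏy≡yxᵏ k))) (ι-mul (false , D₄.negF k) D₄.y)

  ι⁻¹-nothing⇔∉G₀ : ∀ g → ι⁻¹ g ≡ nothing ⇔ (¬ InG₀ g)
  ι⁻¹-nothing⇔∉G₀ g = mk⇔ to from
    where
    to : ι⁻¹ g ≡ nothing → ¬ InG₀ g
    to eq g∈G₀ with InG₀⇒∈image g∈G₀
    ... | p , refl with () ← trans (sym (ι⁻¹-ι p)) eq
    from : ¬ InG₀ g → ι⁻¹ g ≡ nothing
    from g∉G₀ with ι⁻¹ g in eq
    ... | nothing = refl
    ... | just p  = ⊥-elim (g∉G₀ (subst InG₀ (sym (ι⁻¹-just eq)) (ι-InG₀ p)))

module Proof (m : ℕ) .{{_ : NonZero m}} where
  open Setting m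
  open Embedding m
  open DihedralGroup n using (D-isFiniteGroup)
  open ExtensionByZero D-isFiniteGroup D₄.D-isFiniteGroup ι ι-mul ι-inv ι⁻¹ ι⁻¹-ι ι⁻¹-just
  open AdjoinComplement label₄ label₄-isSRing 4 label₄≢4
  open GroupRingProperties D-isFiniteGroup using (InSpan-conv; conv-cong)

  c : Elt → ℕ
  c = extend

  class : Elt → Fin 5
  class g = classᴹ (ι⁻¹ g)

  c≡toℕ∘class : ∀ g → c g ≡ toℕ (class g)
  c≡toℕ∘class g with ι⁻¹ g
  ... | just p  = refl
  ... | nothing = refl

  class-ι : ∀ p → class (ι p) ≡ class₄ p
  class-ι p = cong classᴹ (ι⁻¹-ι p)

  class-∉G₀ : ∀ {g} → ¬ InG₀ g → class g ≡ Fin.fromℕ 4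
  class-∉G₀ {g} g∉G₀ = cong classᴹ (Equivalence.from (ι⁻¹-nothing⇔∉G₀ g) g∉G₀)

  x₀≡ι : x₀ ≡ ι (false , 1F)
  x₀≡ι = cong (λ k → (false , k mod n)) (sym (ℕ.+-identityʳ m))

  x₀²≡ι : x₀² ≡ ι (false , 2F)
  x₀²≡ι = trans (cong₂ _·_ x₀≡ι x₀≡ι) (sym (ι-mul (false , 1F) (false , 1F)))

  x₀³≡ι : x₀³ ≡ ι (false , 3F)
  x₀³≡ι = trans (cong₂ _·_ x₀²≡ι x₀≡ι) (sym (ι-mul (false , 2F) (false , 1F)))

  y·≡ι : ∀ {g} p → g ≡ ι p → y · g ≡ ι (D₄.mul D₄.y p)
  y·≡ι p refl = sym (ι-mul D₄.y p)

  yx₀≡ι : y · x₀ ≡ ι (true , 1F)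
  yx₀≡ι = y·≡ι (false , 1F) x₀≡ι

  yx₀²≡ι : y · x₀² ≡ ι (true , 2F)
  yx₀²≡ι = y·≡ι (false , 2F) x₀²≡ι

  yx₀³≡ι : y · x₀³ ≡ ι (true , 3F)
  yx₀³≡ι = y·≡ι (false , 3F) x₀³≡ι

  class-≡ι : ∀ {g} p → g ≡ ι p → class g ≡ class₄ p
  class-≡ι p refl = class-ι p

  R⇔inR : ∀ g → R g ⇔ T (inR (class g))
  R⇔inR g = mk⇔ to from
    where
    to : R g → T (inR (class g))
    to (inj₁ eq)                        = subst (T ∘ inR) (sym (class-≡ι (false , 2F) (trans eq x₀²≡ι))) _
    to (inj₂ (inj₁ eq))                 = subst (T ∘ inR) (sym (class-≡ι (true , 1F) (trans eq yx₀≡ι))) _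
    to (inj₂ (inj₂ (inj₁ eq)))          = subst (T ∘ inR) (sym (class-≡ι (true , 2F) (trans eq yx₀²≡ι))) _
    to (inj₂ (inj₂ (inj₂ (inj₁ eq))))   = subst (T ∘ inR) (sym (class-≡ι (true , 3F) (trans eq yx₀³≡ι))) _
    to (inj₂ (inj₂ (inj₂ (inj₂ g∉G₀)))) = subst (T ∘ inR) (sym (class-∉G₀ g∉G₀)) _
    R-ι : ∀ p → T (inR (class₄ p)) → R (ι p)
    R-ι (false , 2F) _  = inj₁ (sym x₀²≡ι)
    R-ι (true , 1F) _   = inj₂ (inj₁ (sym yx₀≡ι))
    R-ι (true , 2F) _   = inj₂ (inj₂ (inj₁ (sym yx₀²≡ι)))
    R-ι (true , 3F) _   = inj₂ (inj₂ (inj₂ (inj₁ (sym yx₀³≡ι))))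
    R-ι (false , 0F) ()
    R-ι (false , 1F) ()
    R-ι (false , 3F) ()
    R-ι (true , 0F) ()
    from : T (inR (class g)) → R g
    from inR-g with ι⁻¹ g in eq
    ... | nothing = inj₂ (inj₂ (inj₂ (inj₂ (Equivalence.to (ι⁻¹-nothing⇔∉G₀ g) eq))))
    ... | just p  = subst R (sym (ι⁻¹-just eq)) (R-ι p inR-g)

  Y-class : ∀ g → Y (class g) g
  Y-class g with ι⁻¹ g in eq
  ... | nothing = Equivalence.to (ι⁻¹-nothing⇔∉G₀ g) eq
  ... | just p  = subst (Y (class₄ p)) (sym (ι⁻¹-just eq)) (Y-ι p)
    where
    Y-ι : ∀ p → Y (class₄ p) (ι p)
    Y-ι (false , 0F) = refl
    Y-ι (true , 2F)  = sym yx₀²≡ι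
    Y-ι (true , 0F)  = inj₁ refl
    Y-ι (false , 1F) = inj₂ (inj₁ (sym x₀≡ι))
    Y-ι (false , 3F) = inj₂ (inj₂ (sym x₀³≡ι))
    Y-ι (false , 2F) = inj₁ (sym x₀²≡ι)
    Y-ι (true , 1F)  = inj₂ (inj₁ (sym yx₀≡ι))
    Y-ι (true , 3F)  = inj₂ (inj₂ (sym yx₀³≡ι))

  Y⇒class : ∀ i g → Y i g → class g ≡ i
  Y⇒class 0F g refl             = class-ι (false , 0F)
  Y⇒class 1F g eq               = class-≡ι (true , 2F) (trans eq yx₀²≡ι)
  Y⇒class 2F g (inj₁ eq)        = class-≡ι (true , 0F) eq
  Y⇒class 2F g (inj₂ (inj₁ eq)) = class-≡ι (false , 1F) (trans eq x₀≡ι)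
  Y⇒class 2F g (inj₂ (inj₂ eq)) = class-≡ι (false , 3F) (trans eq x₀³≡ι)
  Y⇒class 3F g (inj₁ eq)        = class-≡ι (false , 2F) (trans eq x₀²≡ι)
  Y⇒class 3F g (inj₂ (inj₁ eq)) = class-≡ι (true , 1F) (trans eq yx₀≡ι)
  Y⇒class 3F g (inj₂ (inj₂ eq)) = class-≡ι (true , 3F) (trans eq yx₀³≡ι)
  Y⇒class 4F g g∉G₀             = class-∉G₀ g∉G₀

  c≡⇔class≡ : ∀ g h → c g ≡ c h ⇔ class g ≡ class h
  c≡⇔class≡ g h = mk⇔
    (λ eq → toℕ-injective (trans (sym (c≡toℕ∘class g)) (trans eq (c≡toℕ∘class h))))
    (λ eq → trans (c≡toℕ∘class g) (trans (cong toℕ eq) (sym (c≡toℕ∘class h))))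

  x∉G₀ : 2 ≤ m → ¬ InG₀ x
  x∉G₀ 2≤m x∈G₀ with InG₀⇒∈image x∈G₀
  ... | (_ , k) , x≡ιp = ℕ.<⇒≢ 2≤m (sym (ℕ.m*n≡1⇒n≡1 (toℕ k) m (begin
    toℕ k ℕ.* m             ≡⟨ toℕ-ψ₄ k ⟨
    toℕ (ψ (toℕ k))         ≡⟨ cong (toℕ ∘ proj₂) x≡ιp ⟨
    toℕ (1 mod n)           ≡⟨ DihedralGroup.toℕ-mod n 1 ⟩
    1 % n                   ≡⟨ m<n⇒m%n≡m (ℕ.≤-trans 2≤m (ℕ.m≤n*m m 4)) ⟩
    1                       ∎)))
    where open ≡-Reasoning

  representative : Fin 5 → Elt
  representative 0F = one
  representative 1F = ι (true , 2F)
  representative 2F = y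
  representative 3F = ι (false , 2F)
  representative 4F = x

  class-representative : 2 ≤ m → ∀ i → class (representative i) ≡ i
  class-representative 2≤m 0F = class-ι (false , 0F)
  class-representative 2≤m 1F = class-ι (true , 2F)
  class-representative 2≤m 2F = class-ι (true , 0F)
  class-representative 2≤m 3F = class-ι (false , 2F)
  class-representative 2≤m 4F = class-∉G₀ (x∉G₀ 2≤m)

  module Minimality (c′ : Elt → ℕ) (c′-isSRing : IsSRing G c′) (R-union : UnionOfBasic G c′ R) where

    Respects : {S : Set} → (Elt → S) → Set
    Respects F = ∀ g h → c′ g ≡ c′ h → F g ≡ F h

    respects-determined : ∀ {S T} {s : Maybe D₄.Elt → S} {t : Maybe D₄.Elt → T} →
                 Respects (s ∘ ι⁻¹) → Determines s t → Respects (t ∘ ι⁻¹)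
    respects-determined s-respected s⇒t g h eq = s⇒t (ι⁻¹ g) (ι⁻¹ h) (s-respected g h eq)

    respects-identity : Respects (λ g → does (c g ℕ.≟ 0))
    respects-identity g h eq = does-⇔ (mk⇔ (λ cg≡0 → one⇒c≡0 (≡one⇒≡one g h eq (c≡0⇒one cg≡0)))
                                           (λ ch≡0 → one⇒c≡0 (≡one⇒≡one h g (sym eq) (c≡0⇒one ch≡0))))
                                      (c g ℕ.≟ 0) (c h ℕ.≟ 0)
      where
      c≡0⇒one : ∀ {g} → c g ≡ 0 → g ≡ one
      c≡0⇒one {g} cg≡0 = IsSRing.singleton-e extend-isSRing g (trans cg≡0 (sym (extend-ι (false , 0F))))
      one⇒c≡0 : ∀ {g} → g ≡ one → c g ≡ 0
      one⇒c≡0 refl = extend-ι (false , 0F)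
      ≡one⇒≡one : ∀ g h → c′ g ≡ c′ h → g ≡ one → h ≡ one
      ≡one⇒≡one g h eq refl = IsSRing.singleton-e c′-isSRing h (sym eq)

    respects-R : Respects (λ g → inR (class g))
    respects-R g h eq = does-⇔ (mk⇔ (λ Tg → to h (R-union g h eq (from g Tg)))
                                    (λ Th → to g (R-union h g (sym eq) (from h Th))))
                               (T? (inR (class g))) (T? (inR (class h)))
      where
      to   = λ g → Equivalence.to (R⇔inR g)
      from = λ g → Equivalence.from (R⇔inR g)

    respects-σ₁ : Respects (σ₁ ∘ ι⁻¹)
    respects-σ₁ g h eq = cong₂ _,_ (respects-identity g h eq) (respects-R g h eq)

    respects-convᴹ : ∀ k l → indᴹ k nothing ≡ + 0 → indᴹ l nothing ≡ + 0 →
                     Respects (indᴹ k ∘ ι⁻¹) → Respects (indᴹ l ∘ ι⁻¹) → Respects (convᴹ k l ∘ ι⁻¹)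
    respects-convᴹ k l k₀ l₀ k-respected l-respected g h eq = begin
      convᴹ k l (ι⁻¹ g)                       ≡⟨ as-conv g ⟨
      conv G (indᴹ k ∘ ι⁻¹) (indᴹ l ∘ ι⁻¹) g  ≡⟨ InSpan-conv c′ c′-isSRing k-respected l-respected g h eq ⟩
      conv G (indᴹ k ∘ ι⁻¹) (indᴹ l ∘ ι⁻¹) h  ≡⟨ as-conv h ⟩
      convᴹ k l (ι⁻¹ h)                       ∎
      where
      open ≡-Reasoning
      as-conv : ∀ g → conv G (indᴹ k ∘ ι⁻¹) (indᴹ l ∘ ι⁻¹) g ≡ convᴹ k l (ι⁻¹ g)
      as-conv g = trans (conv-cong (ext-vanishing (indᴹ k) k₀) (ext-vanishing (indᴹ l) l₀) g) (conv-ext _ _ g)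

    respects-Y₂ : Respects (indᴹ 2 ∘ ι⁻¹)
    respects-Y₂ = respects-determined respects-σ₁ σ₁-determines-Y₂

    respects-σ₂ : Respects (σ₂ ∘ ι⁻¹)
    respects-σ₂ g h eq = cong₂ _,_ (respects-σ₁ g h eq)
                                   (respects-convᴹ 2 2 refl refl respects-Y₂ respects-Y₂ g h eq)

    respects-Y₃ : Respects (indᴹ 3 ∘ ι⁻¹)
    respects-Y₃ = respects-determined respects-σ₂ σ₂-determines-Y₃

    respects-σ₃ : Respects (σ₃ ∘ ι⁻¹)
    respects-σ₃ g h eq = cong₂ _,_ (respects-σ₂ g h eq)
                                   (respects-convᴹ 2 3 refl refl respects-Y₂ respects-Y₃ g h eq)

    c-coarser : SubSRing G c c′
    c-coarser = respects-determined respects-σ₃ σ₃-determines-label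

  c-isWLClosure : IsWLClosure G R c
  c-isWLClosure = record
    { sring    = extend-isSRing
    ; S-union  = λ g h eq Rg → Equivalence.from (R⇔inR h)
                   (subst (T ∘ inR) (Equivalence.to (c≡⇔class≡ g h) eq) (Equivalence.to (R⇔inR g) Rg))
    ; smallest = Minimality.c-coarser
    }

  c-basicSets : 2 ≤ m → BasicSetsAre G c 5 Y
  c-basicSets 2≤m = nonempty , λ g h → mk⇔ (same-Y g h) (same-c g h)
    where
    nonempty : ∀ i → ∃ λ g → Y i g
    nonempty i = representative i ,
                 subst (λ j → Y j (representative i)) (class-representative 2≤m i) (Y-class (representative i))
    same-Y : ∀ g h → c g ≡ c h → ∃ λ i → Y i g × Y i h
    same-Y g h eq = class g , Y-class g ,
                    subst (λ j → Y j h) (sym (Equivalence.to (c≡⇔class≡ g h) eq)) (Y-class h)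
    same-c : ∀ g h → (∃ λ i → Y i g × Y i h) → c g ≡ c h
    same-c g h (i , Yg , Yh) = Equivalence.from (c≡⇔class≡ g h) (trans (Y⇒class i g Yg) (sym (Y⇒class i h Yh)))

  c-rank : 2 ≤ m → HasRank G c 5
  c-rank 2≤m = representative ,
    (λ i j eq → trans (sym (class-representative 2≤m i))
                  (trans (Equivalence.to (c≡⇔class≡ _ _) eq) (class-representative 2≤m j))) ,
    (λ g → class g , Equivalence.from (c≡⇔class≡ g _) (sym (class-representative 2≤m (class g))))

lemma4p4 : (m : ℕ) (hm : 2 ≤ m) →
    Setting.Conclusion m {{2≤⇒NonZero hm}}
lemma4p4 m hm = c , c-isWLClosure , c-basicSets hm , c-rank hm
  where
  instance
    _ = 2≤⇒NonZero hm
  open Proof m
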